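{- For integers $\ell$ and $k$ with $1\le\ell\le3$ and $k\ge\ell$, $\overline{\alpha}(\{1,2k,2k+2\ell\})=\frac{2k}{4k+2\ell}$.
   Context: For a finite set $S$ of positive integers, the distance graph $G(S)$ has vertex set $\mathbb{Z}$, with $i,j$ adjacent iff $|i-j|\in S$. For $A\subseteq\mathbb{Z}$, $\delta(A)=\limsup_{N\to\infty}\frac{|A\cap[-N,N]|}{2N+1}$. The independence ratio $\overline{\alpha}(S)$ is the supremum of $\delta(A)$ over all independent sets $A$ of $G(S)$. -}

module Defs where

open import Data.Bool using (Bool; true; false)
open import Data.Nat using (ℕ; zero; suc; _+_; _*_; _≤_)
open import Data.Integer as ℤ using (ℤ; +_; -[1+_]; ∣_∣; _-_)
open import Data.Rational as ℚ using (ℚ; 0ℚ; _/_)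
open import Data.Product using (_×_; ∃-syntax)
open import Data.Sum using (_⊎_)
open import Relation.Binary.PropositionalEquality using (_≡_)
open import Relation.Nullary using (¬_)

SubsetZ : Set
SubsetZ = ℤ → Bool

DistSet : Set₁
DistSet = ℕ → Set

S₃ : ℕ → ℕ → DistSet
S₃ k l d = (d ≡ 1) ⊎ (d ≡ 2 * k) ⊎ (d ≡ 2 * k + 2 * l)

Independent : DistSet → SubsetZ → Set
Independent S A = ∀ i j → A i ≡ true → A j ≡ true → ¬ S ∣ i - j ∣

b2n : Bool → ℕ
b2n true  = 1
b2n false = 0

-- |A ∩ [-N, N]|
count : SubsetZ → ℕ → ℕ
count A zero    = b2n (A (+ 0))
count A (suc N) = count A N + b2n (A (+ suc N)) + b2n (A -[1+ N ])

-- p / q as a rational (with the junk value 0 when q = 0).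
frac : ℕ → ℕ → ℚ
frac p zero    = 0ℚ
frac p (suc q) = (+ p) / suc q

density : SubsetZ → ℕ → ℚ
density A N = frac (count A N) (suc (2 * N))

-- δ(A) ≤ r  (limsup of the densities is at most r)
DensityAtMost : SubsetZ → ℚ → Set
DensityAtMost A r = ∀ (ε : ℚ) → 0ℚ ℚ.< ε →
  ∃[ N₀ ] ∀ N → N₀ ≤ N → density A N ℚ.≤ r ℚ.+ ε

-- δ(A) > r - ε for the given ε, witnessed as: density exceeds r - ε infinitely often
-- (this yields δ(A) ≥ r - ε, and is implied by δ(A) > r - ε).
DensityInfOftenAbove : SubsetZ → ℚ → Set
DensityInfOftenAbove A c = ∀ N₀ → ∃[ N ] (N₀ ≤ N × c ℚ.< density A N)

-- ᾱ(S) = r, i.e. sup { δ(A) : A independent in G(S) } = r, unfolded: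
--  * every independent A has δ(A) ≤ r, and
--  * for every ε > 0 some independent A has δ(A) ≥ r - ε.
IndependenceRatioIs : DistSet → ℚ → Set
IndependenceRatioIs S r =
  (∀ A → Independent S A → DensityAtMost A r)
  × (∀ (ε : ℚ) → 0ℚ ℚ.< ε →
       ∃[ A ] (Independent S A × DensityInfOftenAbove A (r ℚ.- ε)))

-- Cut a window of 2(2k + l) consecutive integers into 2k + l cells
-- {x + 2j, x + 2j + 1}.  An independent set A meets every cell at most once, so the
-- window becomes a word S over {L, R, E} (left point, right point, no point), and the
-- distances 2k, 2k + 2l and 1 forbid equal letters L or R at distance k or k + l and
-- the factor R L.  Such a word has at least l letters E, hence the window holds at
-- most 2k points of A.  For l ≤ 3 this is checked by a finite automaton that, in
-- step i < k, reads S i and S (k + l + i); its rules do not mention k, so a single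
-- evaluated certificate covers every k ≥ l.
--
-- The residues modulo 4k + 2l that are odd and below 2k, or even and at
-- least 2k + 2l, form an independent set of density 2k / (4k + 2l); it is extended to
-- the negative integers by the reflection x ↦ -1 - x.

module Submission where

open import Defs
open import Level using (0ℓ)
open import Function using (_∘_)
open import Data.Bool using (Bool; true; false)
open import Data.Empty using (⊥; ⊥-elim)
open import Data.Product using (_×_; _,_)
open import Data.Sum using (_⊎_; inj₁; inj₂; [_,_]′)
open import Data.Nat as ℕ
  using (ℕ; zero; suc; _+_; _*_; _∸_; _≤_; _<_; _⊓_; _≤?_; _<?_; _/_; _%_; z≤n; s≤s; parity)
import Data.Nat.Properties as ℕ
open import Data.Nat.DivMod using (m≡m%n+[m/n]*n; m%n<n; m/n*n≤m; m<n⇒m%n≡m; [m+n]%n≡m%n; %-distribˡ-+)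
open import Data.Nat.Coprimality using (Coprime)
open import Data.Nat.Solver using (module +-*-Solver)
open import Data.Parity.Base as ℙ using (Parity; 0ℙ; 1ℙ; _⁻¹)
import Data.Parity.Properties as ℙ
open import Data.Integer as ℤ using (ℤ; +_; -[1+_]; ∣_∣; _⊖_; +≤+; +<+)
import Data.Integer.Properties as ℤ
open import Data.Integer.Solver renaming (module +-*-Solver to ℤ-Solver)
open import Data.Rational as ℚ using (ℚ; mkℚ; toℚᵘ)
import Data.Rational.Properties as ℚ
open import Data.Rational.Unnormalised as ℚᵘ using (mkℚᵘ; *≤*; *<*)
import Data.Rational.Unnormalised.Properties as ℚᵘ
open import Data.Vec using (Vec; []; _∷_; head; last; tail; _∷ʳ_)
import Data.Vec.Properties as Vec
open import Data.Vec.Relation.Binary.Pointwise.Inductive as Pointwise using (Pointwise; []; _∷_)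
open import Data.Vec.Relation.Unary.Linked as Linked using (Linked; []; [-]; _∷_)
open import Data.List using (List; []; _∷_; _++_; concatMap; filter; deduplicate; map)
open import Data.List.Relation.Unary.All as All using (All; all?)
open import Data.List.Relation.Unary.Any using (Any; any?)
open import Relation.Nullary using (¬_; Dec; yes; no; does)
open import Relation.Nullary.Decidable
  using (¬?; _×-dec_; _⊎-dec_; _→-dec_; map′; True; toWitness; dec-true; dec-false)
open import Relation.Binary using (Rel; Decidable; DecidableEquality)
open import Relation.Binary.PropositionalEquality
  using (_≡_; refl; sym; trans; cong; cong₂; subst; subst₂; module ≡-Reasoning)

2*n≡n+n : ∀ n → 2 * n ≡ n + n
2*n≡n+n n = cong (λ m → n + m) (ℕ.+-identityʳ n)

∑< : ℕ → (ℕ → ℕ) → ℕ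
∑< zero    f = 0
∑< (suc n) f = f 0 + ∑< n (f ∘ suc)

syntax ∑< n (λ t → e) = ∑[ t < n ] e

∑<-cong : ∀ n {f g : ℕ → ℕ} → (∀ t → t < n → f t ≡ g t) → ∑< n f ≡ ∑< n g
∑<-cong zero    eq = refl
∑<-cong (suc n) eq = cong₂ _+_ (eq 0 (s≤s z≤n)) (∑<-cong n λ t t<n → eq (suc t) (s≤s t<n))

∑<-+ : ∀ m n (f : ℕ → ℕ) → ∑< (m + n) f ≡ ∑< m f + ∑[ t < n ] f (m + t)
∑<-+ zero    n f = refl
∑<-+ (suc m) n f = trans (cong (λ x → f 0 + x) (∑<-+ m n (f ∘ suc))) (sym (ℕ.+-assoc (f 0) _ _))

∑<-suc : ∀ n (f : ℕ → ℕ) → ∑< (suc n) f ≡ ∑< n f + f n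
∑<-suc n f = begin
  ∑< (suc n) f             ≡⟨ cong (λ m → ∑< m f) (ℕ.+-comm 1 n) ⟩
  ∑< (n + 1) f             ≡⟨ ∑<-+ n 1 f ⟩
  ∑< n f + (f (n + 0) + 0) ≡⟨ cong (λ x → ∑< n f + x)
                                   (trans (ℕ.+-identityʳ _) (cong f (ℕ.+-identityʳ n))) ⟩
  ∑< n f + f n             ∎
  where open ≡-Reasoning

∑<-distrib : ∀ n (f g : ℕ → ℕ) → ∑[ t < n ] (f t + g t) ≡ ∑< n f + ∑< n g
∑<-distrib zero    f g = refl
∑<-distrib (suc n) f g = trans (cong (λ x → f 0 + g 0 + x) (∑<-distrib n (f ∘ suc) (g ∘ suc)))
  (solve 4 (λ a b c d → a :+ b :+ (c :+ d) := a :+ c :+ (b :+ d)) refl (f 0) (g 0) _ _)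
  where open +-*-Solver

∑<-const : ∀ n c → ∑[ _ < n ] c ≡ n * c
∑<-const zero    c = refl
∑<-const (suc n) c = cong (λ x → c + x) (∑<-const n c)

∑<-pairs : ∀ n (f : ℕ → ℕ) → ∑< (n + n) f ≡ ∑[ j < n ] (f (j + j) + f (suc (j + j)))
∑<-pairs zero    f = refl
∑<-pairs (suc n) f rewrite ℕ.+-suc n n =
  trans (sym (ℕ.+-assoc (f 0) (f 1) _))
    (cong (λ x → f 0 + f 1 + x) (trans (∑<-pairs n (f ∘ suc ∘ suc))
      (∑<-cong n λ j _ → cong₂ (λ a b → f a + f b)
                                (cong suc (sym (ℕ.+-suc j j))) (cong (suc ∘ suc) (sym (ℕ.+-suc j j))))))

data Domino : Set where
  L R E : Domino

_≟ᴰ_ : DecidableEquality Domino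
L ≟ᴰ L = yes refl
L ≟ᴰ R = no λ ()
L ≟ᴰ E = no λ ()
R ≟ᴰ L = no λ ()
R ≟ᴰ R = yes refl
R ≟ᴰ E = no λ ()
E ≟ᴰ L = no λ ()
E ≟ᴰ R = no λ ()
E ≟ᴰ E = yes refl

data Clash : Rel Domino 0ℓ where
  LL : Clash L L
  RR : Clash R R

data Jam : Rel Domino 0ℓ where
  RL : Jam R L

clash? : Decidable Clash
clash? L L = yes LL
clash? R R = yes RR
clash? L R = no λ ()
clash? L E = no λ ()
clash? R L = no λ ()
clash? R E = no λ ()
clash? E _ = no λ ()

jam? : Decidable Jam
jam? R L = yes RL
jam? R R = no λ ()
jam? R E = no λ ()
jam? L _ = no λ ()
jam? E _ = no λ ()

empty : Domino → ℕ
empty E = 1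
empty _ = 0

emptiesᵛ : ∀ {n} → Vec Domino n → ℕ
emptiesᵛ []      = 0
emptiesᵛ (x ∷ v) = empty x + emptiesᵛ v

∀-Domino? : {P : Domino → Set} → (∀ x → Dec (P x)) → Dec (∀ x → P x)
∀-Domino? P? with P? L | P? R | P? E
... | yes pL | yes pR | yes pE = yes λ { L → pL ; R → pR ; E → pE }
... | no ¬pL | _      | _      = no λ p → ¬pL (p L)
... | yes _  | no ¬pR | _      = no λ p → ¬pR (p R)
... | yes _  | yes _  | no ¬pE = no λ p → ¬pE (p E)

∀-Vec? : ∀ n {P : Vec Domino n → Set} → (∀ v → Dec (P v)) → Dec (∀ v → P v)
∀-Vec? zero    P? = map′ (λ { p [] → p }) (λ p → p []) (P? [])
∀-Vec? (suc n) P? = map′ (λ { p (x ∷ v) → p x v }) (λ p x v → p (x ∷ v))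
  (∀-Domino? λ x → ∀-Vec? n λ v → P? (x ∷ v))

everyDomino : List Domino
everyDomino = L ∷ R ∷ E ∷ []

vectors : ∀ n → List (Vec Domino n)
vectors zero    = [] ∷ []
vectors (suc n) = concatMap (λ v → map (_∷ v) everyDomino) (vectors n)

record Admissible (k l : ℕ) (S : ℕ → Domino) : Set where
  field
    clash-k   : ∀ j → ¬ Clash (S j) (S (k + j))
    clash-k+l : ∀ j → ¬ Clash (S j) (S (k + l + j))
    jam-1     : ∀ j → ¬ Jam (S j) (S (suc j))

segment : ∀ {A : Set} n → (ℕ → A) → ℕ → Vec A n
segment zero    S j = []
segment (suc n) S j = S j ∷ segment n S (suc j)

segment-∷ʳ : ∀ {A : Set} n (S : ℕ → A) j → segment n S j ∷ʳ S (j + n) ≡ segment (suc n) S j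
segment-∷ʳ zero    S j = cong (λ i → S i ∷ []) (ℕ.+-identityʳ j)
segment-∷ʳ (suc n) S j = cong (S j ∷_)
  (trans (cong (λ i → segment n S (suc j) ∷ʳ S i) (ℕ.+-suc j n)) (segment-∷ʳ n S (suc j)))

last-segment : ∀ {A : Set} n (S : ℕ → A) j → last (segment (suc n) S j) ≡ S (j + n)
last-segment n S j = trans (cong last (sym (segment-∷ʳ n S j))) (Vec.last-∷ʳ (S (j + n)) (segment n S j))

emptiesᵛ-segment : ∀ n S j → emptiesᵛ (segment n S j) ≡ ∑[ t < n ] empty (S (j + t))
emptiesᵛ-segment zero    S j = refl
emptiesᵛ-segment (suc n) S j = cong₂ _+_ (cong (empty ∘ S) (sym (ℕ.+-identityʳ j)))
  (trans (emptiesᵛ-segment n S (suc j)) (∑<-cong n λ t _ → cong (empty ∘ S) (sym (ℕ.+-suc j t))))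

suc[m⊓n]⊓n≡suc[m]⊓n : ∀ m n → suc (m ⊓ n) ⊓ n ≡ suc m ⊓ n
suc[m⊓n]⊓n≡suc[m]⊓n m       zero    = refl
suc[m⊓n]⊓n≡suc[m]⊓n zero    (suc n) = refl
suc[m⊓n]⊓n≡suc[m]⊓n (suc m) (suc n) = cong suc (suc[m⊓n]⊓n≡suc[m]⊓n m n)

module Automaton (m : ℕ) where

  l : ℕ
  l = suc m

  -- After step i of a run on S: start = S[k, k + l), window = S[k + i, k + i + l),
  -- prev = S (i - 1) (E at i = 0), empties counts the E's read so far (start included),
  -- and phase = min i l records whether window has moved past start.
  record State : Set where
    constructor ⟨_,_,_,_,_⟩
    field
      start   : Vec Domino l
      window  : Vec Domino l
      prev    : Domino
      empties : ℕ
      phase   : ℕ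
  open State

  _≟_ : DecidableEquality State
  ⟨ a , b , c , d , e ⟩ ≟ ⟨ a′ , b′ , c′ , d′ , e′ ⟩ =
    map′ (λ { (refl , refl , refl , refl , refl) → refl }) (λ { refl → refl , refl , refl , refl , refl })
      (d ℕ.≟ d′ ×-dec e ℕ.≟ e′ ×-dec c ≟ᴰ c′
        ×-dec Vec.≡-dec _≟ᴰ_ b b′ ×-dec Vec.≡-dec _≟ᴰ_ a a′)

  initial : Vec Domino l → State
  initial v = ⟨ v , v , E , emptiesᵛ v , 0 ⟩

  step : State → Domino → Domino → State
  step ⟨ v , b , u , c , p ⟩ x w = ⟨ v , tail b ∷ʳ w , x , c + empty x + empty w , suc p ⊓ l ⟩

  Allowed : State → Domino → Domino → Set
  Allowed s x w = ¬ Clash x (head (window s)) × ¬ Clash x w × ¬ Jam (last (window s)) w × ¬ Jam (prev s) x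

  allowed? : ∀ s x w → Dec (Allowed s x w)
  allowed? s x w = ¬? (clash? x _) ×-dec ¬? (clash? x w) ×-dec ¬? (jam? _ w) ×-dec ¬? (jam? _ x)

  Final : State → Set
  Final s = phase s ≡ l × ¬ Jam (prev s) (head (start s))
          × Pointwise (λ a b → ¬ Clash a b) (start s) (window s)

  final? : ∀ s → Dec (Final s)
  final? s = phase s ℕ.≟ l ×-dec ¬? (jam? _ _) ×-dec Pointwise.decidable (λ a b → ¬? (clash? a b)) _ _

  Settled : State → Set
  Settled s = l ≤ empties s

  Covered : List State → State → Set
  Covered ts s = Settled s ⊎ Any (s ≡_) ts

  covered? : ∀ ts s → Dec (Covered ts s)
  covered? ts s = l ≤? empties s ⊎-dec any? (s ≟_) ts

  record Certificate (ts : List State) : Set where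
    field
      seeded     : ∀ v → Linked (λ a b → ¬ Jam a b) v → Covered ts (initial v)
      closed     : All (λ s → ∀ x w → Allowed s x w → Covered ts (step s x w)) ts
      neverFinal : All (λ s → ¬ Final s) ts

  certificate? : ∀ ts → Dec (Certificate ts)
  certificate? ts = map′ (λ (a , b , c) → record { seeded = a ; closed = b ; neverFinal = c })
                         (λ c → Certificate.seeded c , Certificate.closed c , Certificate.neverFinal c)
    (∀-Vec? l (λ v → Linked.linked? (λ a b → ¬? (jam? a b)) v →-dec covered? ts (initial v))
     ×-dec all? (λ s → ∀-Domino? λ x → ∀-Domino? λ w →
                         allowed? s x w →-dec covered? ts (step s x w)) ts
     ×-dec all? (λ s → ¬? (final? s)) ts)

  unsettled : List State → List State
  unsettled = filter (λ s → ¬? (l ≤? empties s))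

  moves : State → List State
  moves s = concatMap (λ x → map (step s x) (filter (allowed? s x) everyDomino)) everyDomino

  saturate : ℕ → List State → List State
  saturate zero    ts = ts
  saturate (suc n) ts
    with deduplicate _≟_ (filter (λ t → ¬? (any? (t ≟_) ts)) (unsettled (concatMap moves ts)))
  ... | []  = ts
  ... | new = saturate n (ts ++ new)

  -- Soundness rests on `Certificate` alone: this saturation only proposes the list,
  -- the reachable states with fewer than l empties.
  reachable : List State
  reachable = saturate 100 (deduplicate _≟_ (unsettled
    (map initial (filter (Linked.linked? (λ a b → ¬? (jam? a b))) (vectors l)))))

  module _ {ts : List State} (cert : Certificate ts) where
    open Certificate cert

    covered-step : ∀ {s x w} → Covered ts s → Allowed s x w → Covered ts (step s x w)
    covered-step {⟨ _ , _ , _ , c , _ ⟩} {x} {w} (inj₁ settled) _ =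
      inj₁ (ℕ.≤-trans settled (ℕ.≤-trans (ℕ.m≤m+n c (empty x)) (ℕ.m≤m+n _ (empty w))))
    covered-step {x = x} {w} (inj₂ s∈ts) ok = All.lookup closed s∈ts x w ok

    covered-final : ∀ {s} → Covered ts s → Final s → Settled s
    covered-final (inj₁ settled) _   = settled
    covered-final (inj₂ s∈ts)    fin = ⊥-elim (All.lookup neverFinal s∈ts fin)

    module Run {k : ℕ} {S : ℕ → Domino} (adm : Admissible k l S) (l≤k : l ≤ k) where
      open Admissible adm
      open +-*-Solver

      prevAt : ℕ → Domino
      prevAt zero    = E
      prevAt (suc i) = S i

      front back : ℕ → ℕ
      front i = ∑[ j < i ] empty (S j)
      back  i = ∑[ j < i ] empty (S (k + l + j))

      stateAt : ℕ → State
      stateAt i = ⟨ segment l S k , segment l S (k + i) , prevAt i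
                  , emptiesᵛ (segment l S k) + front i + back i , i ⊓ l ⟩

      stateAt-zero : stateAt 0 ≡ initial (segment l S k)
      stateAt-zero = cong₂ (λ b c → ⟨ segment l S k , b , E , c , 0 ⟩)
        (cong (segment l S) (ℕ.+-identityʳ k)) (trans (ℕ.+-identityʳ _) (ℕ.+-identityʳ _))

      stateAt-suc : ∀ i → step (stateAt i) (S i) (S (k + l + i)) ≡ stateAt (suc i)
      stateAt-suc i rewrite suc[m⊓n]⊓n≡suc[m]⊓n i l =
        cong₂ (λ b c → ⟨ segment l S k , b , S i , c , suc i ⊓ l ⟩) window-eq empties-eq
        where
          window-eq : segment m S (suc (k + i)) ∷ʳ S (k + l + i) ≡ segment l S (k + suc i)
          window-eq = trans (cong (λ j → segment m S (suc (k + i)) ∷ʳ S j)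
                              (solve 3 (λ k m i → k :+ (con 1 :+ m) :+ i := con 1 :+ (k :+ i) :+ m) refl k m i))
                        (trans (segment-∷ʳ m S (suc (k + i))) (cong (segment l S) (sym (ℕ.+-suc k i))))
          e₀ = emptiesᵛ (segment l S k)
          empties-eq : e₀ + front i + back i + empty (S i) + empty (S (k + l + i))
                     ≡ e₀ + front (suc i) + back (suc i)
          empties-eq rewrite ∑<-suc i (λ j → empty (S j)) | ∑<-suc i (λ j → empty (S (k + l + j))) =
            solve 5 (λ a b c d e → a :+ b :+ c :+ d :+ e := a :+ (b :+ d) :+ (c :+ e)) refl
              e₀ (front i) (back i) (empty (S i)) (empty (S (k + l + i)))

      allowedAt : ∀ i → Allowed (stateAt i) (S i) (S (k + l + i))
      allowedAt i = clash-k i , clash-k+l i , jam-window , jam-prev i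
        where
          jam-window : ¬ Jam (last (segment l S (k + i))) (S (k + l + i))
          jam-window rewrite last-segment m S (k + i) =
            subst (λ j → ¬ Jam (S (k + i + m)) (S j))
              (solve 3 (λ k i m → con 1 :+ (k :+ i :+ m) := k :+ (con 1 :+ m) :+ i) refl k i m) (jam-1 (k + i + m))
          jam-prev : ∀ i → ¬ Jam (prevAt i) (S i)
          jam-prev zero    ()
          jam-prev (suc i) = jam-1 i

      jam-free : ∀ n j → Linked (λ a b → ¬ Jam a b) (segment n S j)
      jam-free zero          j = []
      jam-free (suc zero)    j = [-]
      jam-free (suc (suc n)) j = jam-1 j ∷ jam-free (suc n) (suc j)

      clash-free : ∀ n j → Pointwise (λ a b → ¬ Clash a b) (segment n S j) (segment n S (k + j))
      clash-free zero    j = []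
      clash-free (suc n) j = clash-k j
        ∷ subst (λ i → Pointwise (λ a b → ¬ Clash a b) (segment n S (suc j)) (segment n S i))
                (ℕ.+-suc k j) (clash-free n (suc j))

      coveredAt : ∀ i → Covered ts (stateAt i)
      coveredAt zero    = subst (Covered ts) (sym stateAt-zero) (seeded _ (jam-free l k))
      coveredAt (suc i) = subst (Covered ts) (stateAt-suc i) (covered-step (coveredAt i) (allowedAt i))

      finalAt : Final (stateAt k)
      finalAt = ℕ.m≥n⇒m⊓n≡n l≤k , jam-start l≤k , clash-free l k
        where
          jam-start : ∀ {k} → l ≤ k → ¬ Jam (prevAt k) (S k)
          jam-start {suc k} _ = jam-1 k

      empties-total : emptiesᵛ (segment l S k) + front k + back k ≡ ∑[ j < k + l + k ] empty (S j)
      empties-total = sym (begin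
        ∑[ j < k + l + k ] empty (S j)                         ≡⟨ ∑<-+ (k + l) k _ ⟩
        ∑[ j < k + l ] empty (S j) + back k                    ≡⟨ cong (_+ back k) (∑<-+ k l _) ⟩
        front k + ∑[ j < l ] empty (S (k + j)) + back k        ≡⟨ cong (λ e → front k + e + back k)
                                                                     (sym (emptiesᵛ-segment l S k)) ⟩
        front k + emptiesᵛ (segment l S k) + back k            ≡⟨ cong (_+ back k) (ℕ.+-comm (front k) _) ⟩
        emptiesᵛ (segment l S k) + front k + back k            ∎)
        where open ≡-Reasoning

      empties-bound : l ≤ ∑[ j < k + l + k ] empty (S j)
      empties-bound = subst (l ≤_) empties-total (covered-final (coveredAt k) finalAt)

open Automaton using (Certificate; certificate?; reachable)

decide : ∀ m → True (certificate? m (reachable m)) → Certificate m (reachable m)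
decide m = toWitness

certified : ∀ {m} → m ≤ 2 → Certificate m (reachable m)
certified z≤n             = decide 0 _
certified (s≤s z≤n)       = decide 1 _
certified (s≤s (s≤s z≤n)) = decide 2 _

admissible⇒empties : ∀ {k m S} → m ≤ 2 → suc m ≤ k → Admissible k (suc m) S →
                     suc m ≤ ∑[ j < k + suc m + k ] empty (S j)
admissible⇒empties {m = m} m≤2 l≤k adm = Automaton.Run.empties-bound m (certified m≤2) adm l≤k

countIn : SubsetZ → ℤ → ℕ → ℕ
countIn A x n = ∑[ t < n ] b2n (A (x ℤ.+ + t))

domino : Bool → Bool → Domino
domino true  _     = L
domino false true  = R
domino false false = E

dominoesOf : SubsetZ → ℤ → ℕ → Domino
dominoesOf A x j = domino (A (x ℤ.+ + (j + j))) (A (x ℤ.+ + suc (j + j)))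

Disjoint : Bool → Bool → Set
Disjoint a b = a ≡ true → b ≡ true → ⊥

clash-domino : ∀ {a b c d} → Disjoint a c → Disjoint b d → ¬ Clash (domino a b) (domino c d)
clash-domino {true}  {_}    {true}  ac _ LL = ac refl refl
clash-domino {true}  {_}    {false} {true}  _ _ ()
clash-domino {true}  {_}    {false} {false} _ _ ()
clash-domino {false} {true} {false} {true}  _ bd RR = bd refl refl

jam-domino : ∀ {a b c d} → Disjoint b c → ¬ Jam (domino a b) (domino c d)
jam-domino {false} {true} {true}  bc RL = bc refl refl
jam-domino {false} {true} {false} {true}  _ ()
jam-domino {false} {true} {false} {false} _ ()

domino-size : ∀ {a b} → Disjoint a b → b2n a + b2n b + empty (domino a b) ≡ 1
domino-size {true}  {true}  ab = ⊥-elim (ab refl refl)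
domino-size {true}  {false} _ = refl
domino-size {false} {true}  _ = refl
domino-size {false} {false} _ = refl

distance : ∀ x a d → ∣ x ℤ.+ + (a + d) ℤ.- (x ℤ.+ + a) ∣ ≡ d
distance x a d rewrite ℤ.pos-+ a d =
  cong ∣_∣ (solve 3 (λ x a d → x :+ (a :+ d) :- (x :+ a) := d) refl x (+ a) (+ d))
  where open ℤ-Solver

module _ {k l : ℕ} {A : SubsetZ} (ind : Independent (S₃ k l) A) where

  apart : ∀ {d} → S₃ k l d → ∀ x a b → b ≡ a + d → Disjoint (A (x ℤ.+ + a)) (A (x ℤ.+ + b))
  apart sd x a b refl inA inB = ind _ _ inB inA (subst (S₃ k l) (sym (distance x a _)) sd)

  clash-shift : ∀ s → S₃ k l (2 * s) → ∀ x j → ¬ Clash (dominoesOf A x j) (dominoesOf A x (s + j))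
  clash-shift s sd x j = clash-domino
    (apart sd x _ _ (solve 2 (λ s j → (s :+ j) :+ (s :+ j) := j :+ j :+ con 2 :* s) refl s j))
    (apart sd x _ _ (solve 2 (λ s j → con 1 :+ ((s :+ j) :+ (s :+ j)) := con 1 :+ (j :+ j) :+ con 2 :* s)
                             refl s j))
    where open +-*-Solver

  dominoes-admissible : ∀ x → Admissible k l (dominoesOf A x)
  dominoes-admissible x = record
    { clash-k   = clash-shift k (inj₂ (inj₁ refl)) x
    ; clash-k+l = clash-shift (k + l) (inj₂ (inj₂ (ℕ.*-distribˡ-+ 2 k l))) x
    ; jam-1     = λ j → jam-domino
                    (apart (inj₁ refl) x _ _ (cong suc (trans (ℕ.+-suc j j) (ℕ.+-comm 1 (j + j)))))
    }

  countIn-dominoes : ∀ x n → countIn A x (n + n) + ∑[ j < n ] empty (dominoesOf A x j) ≡ n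
  countIn-dominoes x n = begin
    countIn A x (n + n) + ∑[ j < n ] empty (D j)
      ≡⟨ cong (_+ ∑[ j < n ] empty (D j)) (∑<-pairs n (λ t → b2n (A (x ℤ.+ + t)))) ⟩
    ∑[ j < n ] (b2n (A (x ℤ.+ + (j + j))) + b2n (A (x ℤ.+ + suc (j + j)))) + ∑[ j < n ] empty (D j)
      ≡⟨ sym (∑<-distrib n _ _) ⟩
    ∑[ j < n ] (b2n (A (x ℤ.+ + (j + j))) + b2n (A (x ℤ.+ + suc (j + j))) + empty (D j))
      ≡⟨ ∑<-cong n (λ j _ → domino-size (apart (inj₁ refl) x _ _ (ℕ.+-comm 1 (j + j)))) ⟩
    ∑[ _ < n ] 1
      ≡⟨ trans (∑<-const n 1) (ℕ.*-identityʳ n) ⟩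
    n ∎
    where
      open ≡-Reasoning
      D = dominoesOf A x

window-bound : ∀ {k m A} → m ≤ 2 → suc m ≤ k → Independent (S₃ k (suc m)) A →
               ∀ x → countIn A x (4 * k + 2 * suc m) ≤ 2 * k
window-bound {k} {m} {A} m≤2 l≤k ind x =
  subst₂ (λ n b → countIn A x n ≤ b) P+P≡ (sym (2*n≡n+n k)) (ℕ.+-cancelʳ-≤ l _ _ (begin
    countIn A x (P + P) + l                                   ≤⟨ ℕ.+-monoʳ-≤ _ (admissible⇒empties m≤2 l≤k
                                                                   (dominoes-admissible {k} {l} ind x)) ⟩
    countIn A x (P + P) + ∑[ j < P ] empty (dominoesOf A x j) ≡⟨ countIn-dominoes {k} {l} ind x P ⟩
    P                                                         ≡⟨ solve 2 (λ k l → k :+ l :+ k := k :+ k :+ l)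
                                                                         refl k l ⟩
    k + k + l                                                 ∎))
  where
    open ℕ.≤-Reasoning
    open +-*-Solver
    l = suc m
    P = k + l + k
    P+P≡ : P + P ≡ 4 * k + 2 * l
    P+P≡ = solve 2 (λ k l → k :+ l :+ k :+ (k :+ l :+ k) := con 4 :* k :+ con 2 :* l) refl k l

private
  toℚᵘ-/ : ∀ a w → toℚᵘ ((+ a) ℚ./ suc w) ℚᵘ.≃ mkℚᵘ (+ a) w
  toℚᵘ-/ a w = ℚ.toℚᵘ-fromℚᵘ (mkℚᵘ (+ a) w)

  toℚᵘ-/+mkℚ : ∀ a w n e .(cop : Coprime (suc n) (suc e)) →
               toℚᵘ ((+ a) ℚ./ suc w ℚ.+ mkℚ (+ suc n) e cop)
                 ℚᵘ.≃ mkℚᵘ (+ a) w ℚᵘ.+ mkℚᵘ (+ suc n) e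
  toℚᵘ-/+mkℚ a w n e cop = ℚᵘ.≃-trans (ℚ.toℚᵘ-homo-+ ((+ a) ℚ./ suc w) (mkℚ (+ suc n) e cop))
                                      (ℚᵘ.+-cong (toℚᵘ-/ a w) ℚᵘ.≃-refl)

  pos-sum : ∀ a e n w d → (+ a ℤ.* + e ℤ.+ + n ℤ.* + w) ℤ.* + d ≡ + ((a * e + n * w) * d)
  pos-sum a e n w d = trans (cong (ℤ._* + d) (trans (cong₂ ℤ._+_ (sym (ℤ.pos-* a e)) (sym (ℤ.pos-* n w)))
                                                     (sym (ℤ.pos-+ (a * e) (n * w)))))
                            (sym (ℤ.pos-* (a * e + n * w) d))

/≤/+mkℚ : ∀ c d a w n e .(cop : Coprime (suc n) (suc e)) →
          c * (suc w * suc e) ℕ.≤ (a * suc e + suc n * suc w) * suc d →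
          (+ c) ℚ./ suc d ℚ.≤ (+ a) ℚ./ suc w ℚ.+ mkℚ (+ suc n) e cop
/≤/+mkℚ c d a w n e cop h = ℚ.toℚᵘ-cancel-≤
  (ℚᵘ.≤-respʳ-≃ (ℚᵘ.≃-sym (toℚᵘ-/+mkℚ a w n e cop))
  (ℚᵘ.≤-respˡ-≃ (ℚᵘ.≃-sym (toℚᵘ-/ c d))
    (*≤* (subst₂ ℤ._≤_ (ℤ.pos-* c _) (sym (pos-sum a (suc e) (suc n) (suc w) (suc d))) (+≤+ h)))))

/</+mkℚ : ∀ c d a w n e .(cop : Coprime (suc n) (suc e)) →
          c * (suc w * suc e) ℕ.< (a * suc e + suc n * suc w) * suc d →
          (+ c) ℚ./ suc d ℚ.< (+ a) ℚ./ suc w ℚ.+ mkℚ (+ suc n) e cop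
/</+mkℚ c d a w n e cop h = ℚ.toℚᵘ-cancel-<
  (ℚᵘ.<-respʳ-≃ (ℚᵘ.≃-sym (toℚᵘ-/+mkℚ a w n e cop))
  (ℚᵘ.<-respˡ-≃ (ℚᵘ.≃-sym (toℚᵘ-/ c d))
    (*<* (subst₂ ℤ._<_ (ℤ.pos-* c _) (sym (pos-sum a (suc e) (suc n) (suc w) (suc d))) (+<+ h)))))

<+⇒-< : ∀ p q ε → p ℚ.< q ℚ.+ ε → p ℚ.- ε ℚ.< q
<+⇒-< p q ε h = subst₂ ℚ._<_ refl q+ε-ε≡q (ℚ.+-monoˡ-< (ℚ.- ε) h)
  where
    q+ε-ε≡q : q ℚ.+ ε ℚ.- ε ≡ q
    q+ε-ε≡q = trans (ℚ.+-assoc q ε (ℚ.- ε))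
                    (trans (cong (q ℚ.+_) (ℚ.+-inverseʳ ε)) (ℚ.+-identityʳ q))

data PositiveView : ℚ → Set where
  pos : ∀ n e .(cop : Coprime (suc n) (suc e)) → PositiveView (mkℚ (+ suc n) e cop)

positiveView : ∀ {ε} → ℚ.0ℚ ℚ.< ε → PositiveView ε
positiveView {mkℚ (+ suc n) e _} _ = pos n e _
positiveView {mkℚ (+ zero) _ _} (ℚ.*<* (+<+ ()))
positiveView {mkℚ ℤ.-[1+ _ ] _ _} (ℚ.*<* ())

countIn-+ : ∀ A x a b → countIn A x (a + b) ≡ countIn A x a + countIn A (x ℤ.+ + a) b
countIn-+ A x a b = trans (∑<-+ a b _) (cong (λ n → countIn A x a + n) (∑<-cong b λ t _ →
  cong (λ y → b2n (A y)) (trans (cong (λ y → x ℤ.+ y) (ℤ.pos-+ a t)) (sym (ℤ.+-assoc x (+ a) (+ t))))))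

countIn-mono : ∀ A x {a b} → a ≤ b → countIn A x a ≤ countIn A x b
countIn-mono A x {a} {b} a≤b = subst (λ n → countIn A x a ≤ countIn A x n) (ℕ.m+[n∸m]≡n a≤b)
  (subst (countIn A x a ≤_) (sym (countIn-+ A x a (b ℕ.∸ a))) (ℕ.m≤m+n _ _))

countIn-windows : ∀ A {W B} → (∀ x → countIn A x W ≤ B) → ∀ q x → countIn A x (q * W) ≤ q * B
countIn-windows A         bound zero    x = z≤n
countIn-windows A {W} {B} bound (suc q) x = subst (_≤ B + q * B) (sym (countIn-+ A x W (q * W)))
  (ℕ.+-mono-≤ (bound x) (countIn-windows A bound q (x ℤ.+ + W)))

neg-shift : ∀ N t → -[1+ N ] ℤ.+ + suc t ≡ ℤ.- (+ N) ℤ.+ + t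
neg-shift N t = solve 2 (λ n t → :- (con (+ 1) :+ n) :+ (con (+ 1) :+ t) := :- n :+ t) refl (+ N) (+ t)
  where open ℤ-Solver

neg-end : ∀ N → -[1+ N ] ℤ.+ + suc (suc (N + N)) ≡ + suc N
neg-end N = solve 1 (λ n → :- (con (+ 1) :+ n) :+ (con (+ 2) :+ (n :+ n)) := con (+ 1) :+ n) refl (+ N)
  where open ℤ-Solver

count≡countIn : ∀ A N → count A N ≡ countIn A (ℤ.- (+ N)) (suc (N + N))
count≡countIn A zero    = sym (ℕ.+-identityʳ _)
count≡countIn A (suc N) = begin
    count A N + b2n (A (+ suc N)) + b2n (A -[1+ N ])
      ≡⟨ cong (λ c → c + b2n (A (+ suc N)) + b2n (A -[1+ N ])) (count≡countIn A N) ⟩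
    countIn A (ℤ.- (+ N)) (suc (N + N)) + b2n (A (+ suc N)) + b2n (A -[1+ N ])
      ≡⟨ solve 3 (λ a b c → a :+ b :+ c := c :+ (a :+ b)) refl (countIn A (ℤ.- (+ N)) (suc (N + N))) _ _ ⟩
    b2n (A -[1+ N ]) + (countIn A (ℤ.- (+ N)) (suc (N + N)) + b2n (A (+ suc N)))
      ≡⟨ cong₂ _+_ (cong (b2n ∘ A) (sym (ℤ.+-identityʳ -[1+ N ])))
           (sym (trans (∑<-suc (suc (N + N)) g)
                  (cong₂ _+_ (∑<-cong (suc (N + N)) λ t _ → cong (b2n ∘ A) (neg-shift N t))
                             (cong (b2n ∘ A) (neg-end N))))) ⟩
    b2n (A (-[1+ N ] ℤ.+ + 0)) + ∑< (suc (suc (N + N))) g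
      ≡⟨ cong (λ n → b2n (A (-[1+ N ] ℤ.+ + 0)) + ∑< n g) (cong suc (sym (ℕ.+-suc N N))) ⟩
    countIn A (ℤ.- (+ suc N)) (suc (suc N + suc N)) ∎
  where
    open ≡-Reasoning
    open +-*-Solver
    g : ℕ → ℕ
    g t = b2n (A (-[1+ N ] ℤ.+ + suc t))

count-bound : ∀ A {W B} .{{_ : ℕ.NonZero W}} → (∀ x → countIn A x W ≤ B) → ∀ N →
              count A N * W ≤ B * suc (2 * N) + B * W
count-bound A {W} {B} bound N = begin
  count A N * W  ≤⟨ ℕ.*-monoˡ-≤ W count≤ ⟩
  q * B * W      ≡⟨ solve 3 (λ q b w → q :* b :* w := b :* (q :* w)) refl q B W ⟩
  B * (q * W)    ≤⟨ ℕ.*-monoʳ-≤ B qW≤D+W ⟩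
  B * (D + W)    ≡⟨ ℕ.*-distribˡ-+ B D W ⟩
  B * D + B * W  ∎
  where
    open ℕ.≤-Reasoning
    open +-*-Solver
    D = suc (2 * N)
    q = suc (D / W)
    qW≡ : q * W ≡ D / W * W + W
    qW≡ = ℕ.+-comm W (D / W * W)
    D≤qW : D ≤ q * W
    D≤qW = begin
      D                  ≡⟨ m≡m%n+[m/n]*n D W ⟩
      D % W + D / W * W  ≤⟨ ℕ.+-monoˡ-≤ (D / W * W) (ℕ.<⇒≤ (m%n<n D W)) ⟩
      W + D / W * W      ≡⟨⟩
      q * W              ∎
    qW≤D+W : q * W ≤ D + W
    qW≤D+W = subst (_≤ D + W) (sym qW≡) (ℕ.+-monoˡ-≤ W (m/n*n≤m D W))
    count≤ : count A N ≤ q * B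
    count≤ = subst (_≤ q * B) (sym (count≡countIn A N))
      (ℕ.≤-trans (countIn-mono A (ℤ.- (+ N)) (subst (_≤ q * W) (cong suc (2*n≡n+n N)) D≤qW))
                 (countIn-windows A {W} bound q (ℤ.- (+ N))))

density-at-most : ∀ A {W B} → 1 ≤ W → (∀ x → countIn A x W ≤ B) → DensityAtMost A (frac B W)
density-at-most A {suc w} {B} _ bound ε ε>0 with positiveView ε>0
... | pos n e cop = B * suc e , λ N N₀≤N →
  /≤/+mkℚ (count A N) (2 * N) B w n e cop (cross N (ℕ.≤-trans N₀≤N (ℕ.m≤m+n N (N + 0))))
  where
    open ℕ.≤-Reasoning
    open +-*-Solver
    cross : ∀ N → B * suc e ≤ 2 * N →
            count A N * (suc w * suc e) ≤ (B * suc e + suc n * suc w) * suc (2 * N)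
    cross N BE≤2N = begin
      count A N * (suc w * suc e)
        ≡⟨ sym (ℕ.*-assoc (count A N) (suc w) (suc e)) ⟩
      count A N * suc w * suc e
        ≤⟨ ℕ.*-monoˡ-≤ (suc e) (count-bound A bound N) ⟩
      (B * D + B * suc w) * suc e
        ≡⟨ solve 4 (λ b d w e → (b :* d :+ b :* w) :* e := b :* e :* d :+ b :* e :* w) refl B D (suc w) (suc e) ⟩
      B * suc e * D + B * suc e * suc w
        ≤⟨ ℕ.+-monoʳ-≤ (B * suc e * D) (ℕ.*-monoˡ-≤ (suc w) BE≤n′D) ⟩
      B * suc e * D + suc n * D * suc w
        ≡⟨ solve 5 (λ b e d n w → b :* e :* d :+ n :* d :* w := (b :* e :+ n :* w) :* d)
                   refl B (suc e) D (suc n) (suc w) ⟩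
      (B * suc e + suc n * suc w) * D
        ∎
      where
        D = suc (2 * N)
        BE≤n′D : B * suc e ≤ suc n * D
        BE≤n′D = ℕ.≤-trans BE≤2N (ℕ.≤-trans (ℕ.n≤1+n _) (ℕ.m≤n*m D (suc n)))

-- Sets of the form P ∘ fold are symmetric under x ↦ -1 - x.
fold : ℤ → ℕ
fold (+ n)    = n
fold -[1+ n ] = n

∣⊖∣≡⇒ : ∀ a b d → ∣ a ⊖ b ∣ ≡ d → a ≡ b + d ⊎ b ≡ a + d
∣⊖∣≡⇒ a b d h with ℕ.≤-total a b
... | inj₁ a≤b = inj₂ (trans (sym (ℕ.m+[n∸m]≡n a≤b))
                       (cong (λ n → a + n) (trans (sym (ℤ.∣⊖∣-≤ a≤b)) h)))
... | inj₂ b≤a = inj₁ (trans (sym (ℕ.m+[n∸m]≡n b≤a))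
                       (cong (λ n → b + n) (trans (sym (ℤ.∣⊖∣-≤ b≤a)) (trans (ℤ.∣m⊖n∣≡∣n⊖m∣ b a) h))))

fold-distance : ∀ i j {d} → ∣ i ℤ.- j ∣ ≡ d →
                fold i ≡ fold j + d ⊎ fold j ≡ fold i + d ⊎ suc (fold i + fold j) ≡ d
fold-distance (+ a)    (+ b)    h = [ inj₁ , inj₂ ∘ inj₁ ]′
  (∣⊖∣≡⇒ a b _ (trans (cong ∣_∣ (sym (ℤ.[+m]-[+n]≡m⊖n a b))) h))
fold-distance -[1+ a ] -[1+ b ] h = [ inj₂ ∘ inj₁ , inj₁ ]′
  (∣⊖∣≡⇒ b a _ (trans (cong ∣_∣ (sym (ℤ.[+m]-[+n]≡m⊖n b a))) (trans (cong ∣_∣ (sym (neg-neg a b))) h)))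
  where
    neg-neg : ∀ a b → -[1+ a ] ℤ.- -[1+ b ] ≡ + b ℤ.- + a
    neg-neg a b = solve 2 (λ a b → (:- (con (+ 1) :+ a)) :- (:- (con (+ 1) :+ b)) := b :- a) refl (+ a) (+ b)
      where open ℤ-Solver
fold-distance (+ a)    -[1+ b ] h = inj₂ (inj₂ (trans (cong ∣_∣ (sym (pos-neg a b))) h))
  where
    pos-neg : ∀ a b → + a ℤ.- -[1+ b ] ≡ + suc (a + b)
    pos-neg a b = solve 2 (λ a b → a :- (:- (con (+ 1) :+ b)) := con (+ 1) :+ a :+ b) refl (+ a) (+ b)
      where open ℤ-Solver
fold-distance -[1+ a ] (+ b)    h = inj₂ (inj₂ (trans (cong ∣_∣ (sym (neg-pos a b))) h))
  where
    neg-pos : ∀ a b → -[1+ a ] ℤ.- + b ≡ -[1+ (a + b) ]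
    neg-pos a b = solve 2 (λ a b → (:- (con (+ 1) :+ a)) :- b := :- (con (+ 1) :+ a :+ b)) refl (+ a) (+ b)
      where open ℤ-Solver

folded-independent : ∀ {S : DistSet} (P : ℕ → Bool) →
  (∀ {a d} → S d → P a ≡ true → P (a + d) ≡ true → ⊥) →
  (∀ {a b d} → S d → suc (a + b) ≡ d → P a ≡ true → P b ≡ true → ⊥) →
  Independent S (P ∘ fold)
folded-independent P same opposite i j Pi Pj sd with fold-distance i j refl
... | inj₁ e        = same sd Pj (subst (λ n → P n ≡ true) e Pi)
... | inj₂ (inj₁ e) = same sd Pi (subst (λ n → P n ≡ true) e Pj)
... | inj₂ (inj₂ e) = opposite sd e Pi Pj

count-fold : ∀ (P : ℕ → Bool) N → count (P ∘ fold) N ≡ ∑[ t < suc N ] b2n (P t) + ∑[ t < N ] b2n (P t)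
count-fold P zero    = sym (trans (ℕ.+-identityʳ _) (ℕ.+-identityʳ _))
count-fold P (suc N) = begin
  count (P ∘ fold) N + g (suc N) + g N
    ≡⟨ cong (λ c → c + g (suc N) + g N) (count-fold P N) ⟩
  ∑< (suc N) g + ∑< N g + g (suc N) + g N
    ≡⟨ solve 4 (λ a b c d → a :+ b :+ c :+ d := (a :+ c) :+ (b :+ d))
               refl (∑< (suc N) g) (∑< N g) (g (suc N)) (g N) ⟩
  (∑< (suc N) g + g (suc N)) + (∑< N g + g N)
    ≡⟨ sym (cong₂ _+_ (∑<-suc (suc N) g) (∑<-suc N g)) ⟩
  ∑< (suc (suc N)) g + ∑< (suc N) g ∎
  where
    open ≡-Reasoning
    open +-*-Solver
    g = b2n ∘ P

parity-2* : ∀ n → parity (2 * n) ≡ 0ℙ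
parity-2* n = ℙ.*-homo-* 2 n

parity-+-self : ∀ n → parity (n + n) ≡ 0ℙ
parity-+-self n = trans (ℙ.+-homo-+ n n) (ℙ.p+p≡0ℙ (parity n))

parity-suc-+-self : ∀ n → parity (suc (n + n)) ≡ 1ℙ
parity-suc-+-self n = trans (ℙ.+-homo-+ 1 (n + n)) (cong _⁻¹ (parity-+-self n))

does-true⇒ : ∀ {A : Set} (a? : Dec A) → does a? ≡ true → A
does-true⇒ (yes a) _ = a

odd≢even : ∀ {x : Parity} → x ≡ 1ℙ → x ≡ 0ℙ → ⊥
odd≢even refl ()

module Periodic (k₀ l₀ : ℕ) where
  k l K Ld p : ℕ
  k  = suc k₀
  l  = suc l₀
  K  = 2 * k
  Ld = 2 * l
  p  = K + Ld + K

  InPattern : ℕ → Set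
  InPattern r = (parity r ≡ 1ℙ × r < K) ⊎ (parity r ≡ 0ℙ × K + Ld ≤ r)

  inPattern? : ∀ r → Dec (InPattern r)
  inPattern? r = (parity r ℙ.≟ 1ℙ ×-dec r <? K) ⊎-dec (parity r ℙ.≟ 0ℙ ×-dec K + Ld ≤? r)

  periodic : ℕ → Bool
  periodic n = does (inPattern? (n % p))

  periodic⇒InPattern : ∀ {n} → periodic n ≡ true → InPattern (n % p)
  periodic⇒InPattern {n} = does-true⇒ (inPattern? (n % p))

  K<K+Ld : K < K + Ld
  K<K+Ld = ℕ.m<m+n K (s≤s z≤n)

  K+Ld<p : K + Ld < p
  K+Ld<p = ℕ.m<m+n (K + Ld) (s≤s z≤n)

  parity-p : parity p ≡ 0ℙ
  parity-p = trans (cong parity (solve 2 (λ k l → con 2 :* k :+ con 2 :* l :+ con 2 :* k := con 2 :* (k :+ l :+ k))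
                                         refl k l))
                   (parity-2* (k + l + k))
    where open +-*-Solver

  wrap : ∀ r d → r < p → d ≤ p → r + d ≡ (r + d) % p ⊎ r + d ≡ (r + d) % p + p
  wrap r d r<p d≤p with r + d <? p
  ... | yes r+d<p = inj₁ (sym (m<n⇒m%n≡m r+d<p))
  ... | no  r+d≮p = inj₂ (trans (sym (ℕ.m∸n+n≡m p≤r+d)) (cong (_+ p) (sym q%p≡q)))
    where
      p≤r+d = ℕ.≮⇒≥ r+d≮p
      q = r + d ∸ p
      q%p≡q : (r + d) % p ≡ q
      q%p≡q = trans (cong (_% p) (sym (ℕ.m∸n+n≡m p≤r+d)))
        (trans ([m+n]%n≡m%n q p) (m<n⇒m%n≡m (ℕ.+-cancelʳ-< p q p
          (subst (_< p + p) (sym (ℕ.m∸n+n≡m p≤r+d)) (ℕ.+-mono-<-≤ r<p d≤p)))))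

  parity-wrap : ∀ r d {r′} → r + d ≡ r′ ⊎ r + d ≡ r′ + p → parity r′ ≡ parity r ℙ.+ parity d
  parity-wrap r d (inj₁ e) = trans (cong parity (sym e)) (ℙ.+-homo-+ r d)
  parity-wrap r d {r′} (inj₂ e) = begin
    parity r′               ≡⟨ sym (ℙ.+-identityʳ (parity r′)) ⟩
    parity r′ ℙ.+ 0ℙ        ≡⟨ cong (parity r′ ℙ.+_) (sym parity-p) ⟩
    parity r′ ℙ.+ parity p  ≡⟨ sym (ℙ.+-homo-+ r′ p) ⟩
    parity (r′ + p)         ≡⟨ cong parity (sym e) ⟩
    parity (r + d)          ≡⟨ ℙ.+-homo-+ r d ⟩
    parity r ℙ.+ parity d   ∎
    where open ≡-Reasoning

  p≡K+[K+Ld] : p ≡ K + (K + Ld)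
  p≡K+[K+Ld] = ℕ.+-comm (K + Ld) K

  gap-1 : ∀ r → r < p → InPattern r → InPattern ((r + 1) % p) → ⊥
  gap-1 r r<p = go (wrap r 1 r<p (s≤s z≤n))
    where
      r′ = (r + 1) % p
      r+1≡1+r = ℕ.+-comm r 1
      go : r + 1 ≡ r′ ⊎ r + 1 ≡ r′ + p → InPattern r → InPattern r′ → ⊥
      go w (inj₁ (odd , _)) (inj₁ (odd′ , _)) =
        odd≢even odd′ (trans (parity-wrap r 1 w) (cong (ℙ._+ 1ℙ) odd))
      go w (inj₂ (even , _)) (inj₂ (even′ , _)) =
        odd≢even (trans (parity-wrap r 1 w) (cong (ℙ._+ 1ℙ) even)) even′
      go (inj₁ e) (inj₁ (_ , r<K)) (inj₂ (_ , K+Ld≤r′)) =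
        ℕ.<⇒≱ K<K+Ld (ℕ.≤-trans K+Ld≤r′ (subst (_≤ K) (trans (sym r+1≡1+r) e) r<K))
      go (inj₂ e) (inj₁ (_ , r<K)) (inj₂ _) =
        ℕ.<⇒≱ (ℕ.<-trans K<K+Ld K+Ld<p) (ℕ.≤-trans (ℕ.m≤n+m p r′) (subst (_≤ K) (trans (sym r+1≡1+r) e) r<K))
      go (inj₁ e) (inj₂ (_ , K+Ld≤r)) (inj₁ (_ , r′<K)) =
        ℕ.<⇒≱ r′<K (ℕ.≤-trans (ℕ.<⇒≤ K<K+Ld)
                      (ℕ.≤-trans K+Ld≤r (ℕ.≤-trans (ℕ.n≤1+n r) (ℕ.≤-reflexive (trans (sym r+1≡1+r) e)))))
      go (inj₂ e) (inj₂ _) (inj₁ (odd′ , _)) = odd≢even odd′ (cong parity r′≡0)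
        where
          r′≡0 : r′ ≡ 0
          r′≡0 = ℕ.n≤0⇒n≡0 (ℕ.+-cancelʳ-≤ p r′ 0 (subst (_≤ p) (trans (sym r+1≡1+r) e) r<p))

  gap-even : ∀ r d → r < p → parity d ≡ 0ℙ → K ≤ d → d ≤ K + Ld →
             InPattern r → InPattern ((r + d) % p) → ⊥
  gap-even r d r<p even-d K≤d d≤K+Ld = go w
    where
      r′ = (r + d) % p
      w = wrap r d r<p (ℕ.≤-trans d≤K+Ld (ℕ.<⇒≤ K+Ld<p))
      same-parity : parity r′ ≡ parity r
      same-parity = trans (parity-wrap r d w) (trans (cong (parity r ℙ.+_) even-d) (ℙ.+-identityʳ (parity r)))
      go : r + d ≡ r′ ⊎ r + d ≡ r′ + p → InPattern r → InPattern r′ → ⊥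
      go _ (inj₁ (odd , _)) (inj₂ (even′ , _)) = odd≢even (trans same-parity odd) even′
      go _ (inj₂ (even , _)) (inj₁ (odd′ , _)) = odd≢even odd′ (trans same-parity even)
      go (inj₁ e) (inj₁ _) (inj₁ (_ , r′<K)) =
        ℕ.<⇒≱ r′<K (ℕ.≤-trans K≤d (ℕ.≤-trans (ℕ.m≤n+m d r) (ℕ.≤-reflexive e)))
      go (inj₂ e) (inj₁ (_ , r<K)) (inj₁ _) =
        ℕ.<⇒≱ (subst (r + d <_) (sym p≡K+[K+Ld]) (ℕ.+-mono-<-≤ r<K d≤K+Ld))
              (ℕ.≤-trans (ℕ.m≤n+m p r′) (ℕ.≤-reflexive (sym e)))
      go (inj₁ e) (inj₂ (_ , K+Ld≤r)) (inj₂ _) =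
        ℕ.<⇒≱ (m%n<n (r + d) p) (ℕ.≤-trans (ℕ.+-mono-≤ K+Ld≤r K≤d) (ℕ.≤-reflexive e))
      go (inj₂ e) (inj₂ _) (inj₂ (_ , K+Ld≤r′)) =
        ℕ.<⇒≱ (ℕ.+-mono-<-≤ r<p (ℕ.≤-trans d≤K+Ld K+Ld≤r′)) (ℕ.≤-reflexive (trans (ℕ.+-comm p r′) (sym e)))

  S₃-bound : ∀ {d} → S₃ k l d → d ≤ K + Ld
  S₃-bound (inj₁ refl)        = ℕ.≤-trans (s≤s z≤n) (ℕ.<⇒≤ K<K+Ld)
  S₃-bound (inj₂ (inj₁ refl)) = ℕ.<⇒≤ K<K+Ld
  S₃-bound (inj₂ (inj₂ refl)) = ℕ.≤-refl

  mod-shift : ∀ a {d} → d < p → (a + d) % p ≡ (a % p + d) % p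
  mod-shift a {d} d<p = trans (%-distribˡ-+ a d p) (cong (λ x → (a % p + x) % p) (m<n⇒m%n≡m d<p))

  parity-K+Ld : parity (K + Ld) ≡ 0ℙ
  parity-K+Ld = trans (ℙ.+-homo-+ K Ld) (cong₂ ℙ._+_ (parity-2* k) (parity-2* l))

  gap-same : ∀ {a d} → S₃ k l d → InPattern (a % p) → InPattern ((a + d) % p) → ⊥
  gap-same {a} sd Pa Pa+d = gap sd (subst InPattern (mod-shift a (ℕ.≤-<-trans (S₃-bound sd) K+Ld<p)) Pa+d)
    where
      gap : ∀ {d} → S₃ k l d → InPattern ((a % p + d) % p) → ⊥
      gap (inj₁ refl)        = gap-1 (a % p) (m%n<n a p) Pa
      gap (inj₂ (inj₁ refl)) = gap-even (a % p) K (m%n<n a p) (parity-2* k) ℕ.≤-refl (ℕ.<⇒≤ K<K+Ld) Pa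
      gap (inj₂ (inj₂ refl)) =
        gap-even (a % p) (K + Ld) (m%n<n a p) parity-K+Ld (ℕ.<⇒≤ K<K+Ld) ℕ.≤-refl Pa

  odd-below : ∀ {r} → InPattern r → r < K + Ld → parity r ≡ 1ℙ
  odd-below (inj₁ (odd , _))     _       = odd
  odd-below (inj₂ (_ , K+Ld≤r)) r<K+Ld = ⊥-elim (ℕ.<⇒≱ r<K+Ld K+Ld≤r)

  gap-opposite : ∀ {a b d} → S₃ k l d → suc (a + b) ≡ d → InPattern (a % p) → InPattern (b % p) → ⊥
  gap-opposite {a} {b} {d} sd e Pa Pb = contra sd e
    where
      odd-below-d : ∀ {x} → x < d → InPattern (x % p) → parity x ≡ 1ℙ
      odd-below-d x<d Px = odd-below (subst InPattern (m<n⇒m%n≡m (ℕ.<-≤-trans x<d (ℕ.<⇒≤ d<p))) Px)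
                                     (ℕ.<-≤-trans x<d (S₃-bound sd))
        where d<p = ℕ.≤-<-trans (S₃-bound sd) K+Ld<p
      odd-a : parity a ≡ 1ℙ
      odd-a = odd-below-d (subst (a <_) e (s≤s (ℕ.m≤m+n a b))) Pa
      odd-b : parity b ≡ 1ℙ
      odd-b = odd-below-d (subst (b <_) e (s≤s (ℕ.m≤n+m b a))) Pb
      odd-sum : parity (suc (a + b)) ≡ 1ℙ
      odd-sum = trans (ℙ.+-homo-+ 1 (a + b))
                      (cong (1ℙ ℙ.+_) (trans (ℙ.+-homo-+ a b) (cong₂ ℙ._+_ odd-a odd-b)))
      contra : ∀ {d′} → S₃ k l d′ → suc (a + b) ≡ d′ → ⊥
      contra (inj₁ refl)        e′ = odd≢even odd-a (cong parity (ℕ.m+n≡0⇒m≡0 a (ℕ.suc-injective e′)))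
      contra (inj₂ (inj₁ refl)) e′ = odd≢even (trans (cong parity (sym e′)) odd-sum) (parity-2* k)
      contra (inj₂ (inj₂ refl)) e′ = odd≢even (trans (cong parity (sym e′)) odd-sum) parity-K+Ld

  A : SubsetZ
  A = periodic ∘ fold

  independent : Independent (S₃ k l) A
  independent = folded-independent periodic
    (λ {a} {d} sd Pa Pa+d → gap-same {a} {d} sd (periodic⇒InPattern {a} Pa) (periodic⇒InPattern {a + d} Pa+d))
    (λ {a} {b} sd e Pa Pb → gap-opposite {a} {b} sd e (periodic⇒InPattern {a} Pa) (periodic⇒InPattern {b} Pb))

  even-above : ∀ {t} → InPattern t → K ≤ t → parity t ≡ 0ℙ
  even-above (inj₁ (_ , t<K))  K≤t = ⊥-elim (ℕ.<⇒≱ t<K K≤t)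
  even-above (inj₂ (even , _)) _   = even

  middle-out : ∀ {t} → K ≤ t → t < K + Ld → ¬ InPattern t
  middle-out K≤t _      (inj₁ (_ , t<K))     = ℕ.<⇒≱ t<K K≤t
  middle-out _   t<K+Ld (inj₂ (_ , K+Ld≤t)) = ℕ.<⇒≱ t<K+Ld K+Ld≤t

  χ : ℕ → ℕ
  χ t = b2n (periodic t)

  χ-in : ∀ {t} → t < p → InPattern t → χ t ≡ 1
  χ-in {t} t<p Pt rewrite m<n⇒m%n≡m t<p | dec-true (inPattern? t) Pt = refl

  χ-out : ∀ {t} → t < p → ¬ InPattern t → χ t ≡ 0
  χ-out {t} t<p ¬Pt rewrite m<n⇒m%n≡m t<p | dec-false (inPattern? t) ¬Pt = refl

  sum-pairs : ∀ s → (∀ j → j < k → χ (s + (j + j)) + χ (s + suc (j + j)) ≡ 1) →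
              ∑[ t < K ] χ (s + t) ≡ k
  sum-pairs s pair = begin
    ∑[ t < K ] χ (s + t)                                ≡⟨ cong (λ n → ∑[ t < n ] χ (s + t)) (2*n≡n+n k) ⟩
    ∑[ t < k + k ] χ (s + t)                            ≡⟨ ∑<-pairs k (λ t → χ (s + t)) ⟩
    ∑[ j < k ] (χ (s + (j + j)) + χ (s + suc (j + j))) ≡⟨ ∑<-cong k pair ⟩
    ∑[ _ < k ] 1                                        ≡⟨ trans (∑<-const k 1) (ℕ.*-identityʳ k) ⟩
    k                                                   ∎
    where open ≡-Reasoning

  1+j+j<K : ∀ {j} → j < k → suc (j + j) < K
  1+j+j<K {j} j<k = subst₂ _≤_ (cong suc (ℕ.+-suc j j)) (sym (2*n≡n+n k)) (ℕ.+-mono-≤ j<k j<k)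

  period-sum : ∑[ t < p ] χ t ≡ K
  period-sum = begin
    ∑< p χ
      ≡⟨ ∑<-+ (K + Ld) K χ ⟩
    ∑< (K + Ld) χ + ∑[ t < K ] χ (K + Ld + t)
      ≡⟨ cong (_+ ∑[ t < K ] χ (K + Ld + t)) (∑<-+ K Ld χ) ⟩
    ∑[ t < K ] χ (0 + t) + ∑[ t < Ld ] χ (K + t) + ∑[ t < K ] χ (K + Ld + t)
      ≡⟨ cong₂ _+_ (cong₂ _+_ first-block middle-block) last-block ⟩
    k + 0 + k
      ≡⟨ trans (cong (_+ k) (ℕ.+-identityʳ k)) (sym (2*n≡n+n k)) ⟩
    K ∎
    where
      open ≡-Reasoning
      K<p : K < p
      K<p = ℕ.<-trans K<K+Ld K+Ld<p
      first-block : ∑[ t < K ] χ (0 + t) ≡ k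
      first-block = sum-pairs 0 λ j j<k → cong₂ _+_
        (χ-out (ℕ.<-trans (ℕ.<-trans (ℕ.n<1+n _) (1+j+j<K j<k)) K<p)
               (λ P → odd≢even (odd-below P (ℕ.<-trans (ℕ.<-trans (ℕ.n<1+n _) (1+j+j<K j<k)) K<K+Ld))
                               (parity-+-self j)))
        (χ-in (ℕ.<-trans (1+j+j<K j<k) K<p) (inj₁ (parity-suc-+-self j , 1+j+j<K j<k)))
      middle-block : ∑[ t < Ld ] χ (K + t) ≡ 0
      middle-block = trans (∑<-cong Ld λ t t<Ld → χ-out (ℕ.<-trans (ℕ.+-monoʳ-< K t<Ld) K+Ld<p)
                                                   (middle-out (ℕ.m≤m+n K t) (ℕ.+-monoʳ-< K t<Ld)))
                     (trans (∑<-const Ld 0) (ℕ.*-zeroʳ Ld))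
      last-block : ∑[ t < K ] χ (K + Ld + t) ≡ k
      last-block = sum-pairs (K + Ld) λ j j<k → cong₂ _+_
        (χ-in (ℕ.+-monoʳ-< (K + Ld) (ℕ.<-trans (ℕ.n<1+n _) (1+j+j<K j<k)))
              (inj₂ (trans (ℙ.+-homo-+ (K + Ld) (j + j)) (cong₂ ℙ._+_ parity-K+Ld (parity-+-self j))
                    , ℕ.m≤m+n (K + Ld) _)))
        (χ-out (ℕ.+-monoʳ-< (K + Ld) (1+j+j<K j<k))
               (λ P → odd≢even (trans (ℙ.+-homo-+ (K + Ld) (suc (j + j)))
                                      (cong₂ ℙ._+_ parity-K+Ld (parity-suc-+-self j)))
                               (even-above P (ℕ.≤-trans (ℕ.m≤m+n K Ld) (ℕ.m≤m+n (K + Ld) _)))))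

  χ-periodic : ∀ t → χ (p + t) ≡ χ t
  χ-periodic t = cong (λ n → b2n (does (inPattern? n))) (trans (cong (_% p) (ℕ.+-comm p t)) ([m+n]%n≡m%n t p))

  sum-periods : ∀ M → ∑< (M * p) χ ≡ M * K
  sum-periods zero    = refl
  sum-periods (suc M) = trans (∑<-+ p (M * p) χ)
    (cong₂ _+_ period-sum (trans (∑<-cong (M * p) λ t _ → χ-periodic t) (sum-periods M)))

  p≡4k+2l : p ≡ 4 * k + 2 * l
  p≡4k+2l = solve 2 (λ k l → con 2 :* k :+ con 2 :* l :+ con 2 :* k := con 4 :* k :+ con 2 :* l) refl k l
    where open +-*-Solver

  count-periods : ∀ M → M * K + M * K ≤ count A (M * (4 * k + 2 * l))
  count-periods M = subst (λ W → M * K + M * K ≤ count A (M * W)) p≡4k+2l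
    (subst (M * K + M * K ≤_) (sym (count-fold periodic (M * p)))
      (subst (λ n → n + n ≤ ∑< (suc (M * p)) χ + ∑< (M * p) χ) (sum-periods M)
        (ℕ.+-monoˡ-≤ (∑< (M * p) χ) (subst (∑< (M * p) χ ≤_) (sym (∑<-suc (M * p) χ)) (ℕ.m≤m+n _ _)))))

density-often-above : ∀ A {W B} → 1 ≤ W → (∀ M → M * B + M * B ≤ count A (M * W)) →
                      ∀ ε → ℚ.0ℚ ℚ.< ε → DensityInfOftenAbove A (frac B W ℚ.- ε)
density-often-above A {suc w} {B} _ lower ε ε>0 with positiveView ε>0
... | pos n e cop = λ N₀ → M N₀ * W , N₀≤MW N₀ ,
  <+⇒-< _ _ _ (/</+mkℚ B w (count A (M N₀ * W)) (2 * (M N₀ * W)) n e cop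
                (cross (M N₀) (ℕ.m≤n+m _ N₀)))
  where
    W = suc w
    M : ℕ → ℕ
    M N₀ = N₀ + B * suc e
    N₀≤MW : ∀ N₀ → N₀ ≤ M N₀ * W
    N₀≤MW N₀ = ℕ.≤-trans (ℕ.m≤m+n N₀ _) (ℕ.m≤m*n (M N₀) W)
    cross : ∀ M → B * suc e ≤ M → let N = M * W; D = suc (2 * N) in
            B * (D * suc e) ℕ.< (count A N * suc e + suc n * D) * W
    cross M BE≤M = begin-strict
      B * (D * suc e)
        ≡⟨ solve 3 (λ b d e → b :* ((con 1 :+ d) :* e) := b :* d :* e :+ b :* e) refl B (2 * N) (suc e) ⟩
      B * (2 * N) * suc e + B * suc e
        <⟨ ℕ.+-monoʳ-< (B * (2 * N) * suc e) BE<n′DW ⟩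
      B * (2 * N) * suc e + suc n * D * W
        ≤⟨ ℕ.+-monoˡ-≤ (suc n * D * W) (ℕ.*-monoˡ-≤ (suc e) B2N≤cW) ⟩
      c * W * suc e + suc n * D * W
        ≡⟨ solve 5 (λ c w e n d → c :* w :* e :+ n :* d :* w := (c :* e :+ n :* d) :* w) refl c W (suc e) (suc n) D ⟩
      (c * suc e + suc n * D) * W
        ∎
      where
        open ℕ.≤-Reasoning
        open +-*-Solver
        N = M * W
        c = count A N
        D = suc (2 * N)
        B2N≤cW : B * (2 * N) ≤ c * W
        B2N≤cW = begin
          B * (2 * N)           ≡⟨ solve 3 (λ b m w → b :* (con 2 :* (m :* w)) := (m :* b :+ m :* b) :* w)
                                           refl B M W ⟩
          (M * B + M * B) * W   ≤⟨ ℕ.*-monoˡ-≤ W (lower M) ⟩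
          c * W                 ∎
        BE<n′DW : B * suc e ℕ.< suc n * D * W
        BE<n′DW = begin-strict
          B * suc e      ≤⟨ BE≤M ⟩
          M              ≤⟨ ℕ.m≤m*n M W ⟩
          N              ≤⟨ ℕ.m≤m+n N (N + 0) ⟩
          2 * N          <⟨ ℕ.n<1+n (2 * N) ⟩
          D              ≤⟨ ℕ.m≤n*m D (suc n) ⟩
          suc n * D      ≤⟨ ℕ.m≤m*n (suc n * D) W ⟩
          suc n * D * W  ∎

theorem31 : ∀ (l k : ℕ) → 1 ≤ l → l ≤ 3 → l ≤ k →
    IndependenceRatioIs (S₃ k l) (frac (2 * k) (4 * k + 2 * l))
theorem31 (suc m) (suc k₀) (s≤s z≤n) (s≤s m≤2) l≤k =
    (λ A ind → density-at-most A (s≤s z≤n) (window-bound m≤2 l≤k ind))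
  , (λ ε ε>0 → A , independent , density-often-above A (s≤s z≤n) count-periods ε ε>0)
  where open Periodic k₀ m
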